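{- Let $r\geq 2$. If $G$ is a co-chordal graph (i.e. its complement graph is chordal), then $\Sigma_r(G)$ is vertex decomposable.
   Context: $\Sigma_r(G)$ is the simplicial complex generated by the sets $V(G)\setminus W$ over all $r$-subsets $W\subseteq V(G)$ with $G[W]$ connected (void complex if none). A graph is chordal if it has no induced cycle of length $\ge 4$. Vertex decomposable: the complex is a simplex, the empty complex $\{\emptyset\}$, the void complex, or has a vertex $x$ with $\mathrm{lk}(x)$ and $\mathrm{del}(x)$ vertex decomposable and every facet of $\mathrm{del}(x)$ a facet of the complex. -}

module Defs where

open import Data.Nat using (ℕ; zero; suc; _≤_)
open import Data.Fin using (Fin; toℕ)
open import Data.Fin.Properties using (_≟_)
open import Data.Fin.Subset using (Subset; _∈_; _∉_; _⊆_; ∁; ∣_∣; ⁅_⁆; _∪_; ⊥)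
open import Data.Bool using (Bool; true; false; not)
open import Data.Product using (Σ; _×_; ∃; ∃-syntax)
open import Data.Sum using (_⊎_)
open import Relation.Nullary using (¬_; yes; no)
open import Relation.Binary.PropositionalEquality using (_≡_)
open import Function using (Injective; _⇔_)

record Graph (n : ℕ) : Set where
  field
    adj   : Fin n → Fin n → Bool
    sym   : ∀ i j → adj i j ≡ adj j i
    irrefl : ∀ i → adj i i ≡ false
open Graph public

Adj : ∀ {n} → Graph n → Fin n → Fin n → Set
Adj G i j = adj G i j ≡ true

complement : ∀ {n} → Graph n → Graph n
complement {n} G = record { adj = a ; sym = s ; irrefl = ir }
  where
  a : Fin n → Fin n → Bool
  a i j with i ≟ j
  ... | yes _ = false
  ... | no  _ = not (adj G i j)
  s : ∀ i j → a i j ≡ a j i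
  s i j with i ≟ j | j ≟ i
  ... | yes _ | yes _ = _≡_.refl
  ... | yes p | no ¬q = Data.Empty.⊥-elim (¬q (Relation.Binary.PropositionalEquality.sym p))
    where import Data.Empty
  ... | no ¬p | yes q = Data.Empty.⊥-elim (¬p (Relation.Binary.PropositionalEquality.sym q))
    where import Data.Empty
  ... | no _ | no _ rewrite Graph.sym G i j = _≡_.refl
  ir : ∀ i → a i i ≡ false
  ir i with i ≟ i
  ... | yes _ = _≡_.refl
  ... | no ¬p = Data.Empty.⊥-elim (¬p _≡_.refl)
    where import Data.Empty

CycNeighbour : (k : ℕ) → Fin k → Fin k → Set
CycNeighbour k i j =
    (suc (toℕ i) ≡ toℕ j) ⊎ (suc (toℕ j) ≡ toℕ i)
  ⊎ ((toℕ i ≡ 0 × suc (toℕ j) ≡ k) ⊎ (toℕ j ≡ 0 × suc (toℕ i) ≡ k))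

InducedCycle : ∀ {n} → Graph n → (k : ℕ) → Set
InducedCycle {n} G k =
  Σ (Fin k → Fin n) λ c →
    Injective _≡_ _≡_ c × (∀ i j → Adj G (c i) (c j) ⇔ CycNeighbour k i j)

Chordal : ∀ {n} → Graph n → Set
Chordal G = ∀ k → 4 ≤ k → ¬ InducedCycle G k

-- walks in G all of whose vertices lie in W (the start vertex is
-- required to lie in W separately)
data WalkIn {n} (G : Graph n) (W : Subset n) : Fin n → Fin n → Set where
  here : ∀ {u} → WalkIn G W u u
  step : ∀ {u w v} → Adj G u w → w ∈ W → WalkIn G W w v → WalkIn G W u v

InducedConnected : ∀ {n} → Graph n → Subset n → Set
InducedConnected G W = ∀ u v → u ∈ W → v ∈ W → WalkIn G W u v

Complex : ℕ → Set₁
Complex n = Subset n → Set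

Sigma : ∀ {n} → Graph n → ℕ → Complex n
Sigma G r F = ∃[ W ] (∣ W ∣ ≡ r × InducedConnected G W × F ⊆ ∁ W)

link : ∀ {n} → Complex n → Fin n → Complex n
link Δ x F = x ∉ F × Δ (F ∪ ⁅ x ⁆)

deletion : ∀ {n} → Complex n → Fin n → Complex n
deletion Δ x F = x ∉ F × Δ F

IsFacet : ∀ {n} → Complex n → Subset n → Set
IsFacet Δ F = Δ F × (∀ H → Δ H → F ⊆ H → H ≡ F)

data VertexDecomposable {n} : Complex n → Set₁ where
  simplex   : ∀ {Δ} (σ : Subset n) → (∀ F → Δ F ⇔ F ⊆ σ) → VertexDecomposable Δ
  emptyCx   : ∀ {Δ} → (∀ F → Δ F ⇔ F ≡ ⊥) → VertexDecomposable Δ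
  void      : ∀ {Δ} → (∀ F → ¬ Δ F) → VertexDecomposable Δ
  shedding  : ∀ {Δ} (x : Fin n) → Δ ⁅ x ⁆
            → VertexDecomposable (link Δ x)
            → VertexDecomposable (deletion Δ x)
            → (∀ F → IsFacet (deletion Δ x) F → IsFacet Δ F)
            → VertexDecomposable Δ

{-# OPTIONS --safe #-}

-- Write Σ[ S , T ] for the faces F ⊆ ∁ T avoiding some connected r-set W with S ⊆ W ⊆ ∁ T;
-- Σ[ ⊥ , ⊥ ] is Σ_r(G). Induct on S ∪ T with S connected. If ∣ S ∣ = r the complex is the
-- simplex on ∁ (S ∪ T). Otherwise pick y ∉ S ∪ T adjacent to S, or, when S = ∅, a simplicial
-- vertex y of the chordal complement on ∁ T (Dirac). Any admissible W avoiding y then has a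
-- non-cut vertex z outside S whose exchange for y is again admissible, so y is a shedding
-- vertex with link Σ[ S , T ∪ ⁅ y ⁆ ] and deletion Σ[ S ∪ ⁅ y ⁆ , T ].
module Submission where

open import Defs hiding (sym)
open import Data.Bool using (true)
import Data.Bool as Bool
import Data.Bool.Properties as Bool
open import Data.Fin using (Fin) renaming (zero to fzero; suc to fsuc)
open import Data.Fin.Properties using (_≟_; any?; all?; toℕ-injective; toℕ<n)
open import Data.Fin.Subset using (Subset; _∈_; _∉_; _⊆_; _⊂_; ∁; ∣_∣; ⁅_⁆; _∪_; _─_; _-_; ⊥; Nonempty; Empty; inside; outside)
open import Data.Fin.Subset.Properties
  using (_∈?_; _⊆?_; anySubset?; nonempty?; x∈⁅x⁆; x∈⁅y⁆⇒x≡y; x∉⁅y⁆⇒x≢y; x∈p∪q⁻; p⊆p∪q; q⊆p∪q; p─q⊆p;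
         x∈p∧x≢y⇒x∈p-y; x∈∁p⇒x∉p; x∉p⇒x∈∁p; ∉⊥; ⊥⊆; ⊆-antisym; ∪-identityʳ; p─⊥≡p; Empty-unique; ∣⊥∣≡0;
         p⊂q⇒∣p∣<∣q∣; p⊂q⇒∁p⊃∁q; x∈p⇒∣p-x∣<∣p∣)
open import Data.Nat using (ℕ; zero; suc; _≤_; _<_; _+_; z≤n; s≤s)
import Data.Nat.Properties as ℕ
import Data.Nat.Induction as ℕ
open import Data.Product using (_×_; ∃-syntax; _,_; proj₁; proj₂)
open import Data.Product.Function.NonDependent.Propositional using (_×-⇔_)
open import Data.Sum using (_⊎_; inj₁; inj₂; [_,_]′)
import Data.Sum as Sum
open import Data.Vec using (_∷_; tabulate; here; there)
open import Data.Vec.Properties using ([]=⇒lookup; lookup⇒[]=; lookup∘tabulate)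
open import Function using (id; _∘_; _⇔_; mk⇔; Equivalence)
import Function.Properties.Equivalence as ⇔
open import Induction.WellFounded using (Acc; acc)
open import Relation.Nullary using (¬_; Dec; yes; no; does; contradiction; ¬?)
open import Relation.Nullary.Decidable using (_×-dec_; _⊎-dec_; _→-dec_; map′; decidable-stable; dec-true)
open import Relation.Binary.PropositionalEquality using (_≡_; _≢_; refl; sym; trans; cong; subst; subst₂)

private variable n : ℕ

select : {P : Fin n → Set} → (∀ i → Dec (P i)) → Subset n
select P? = tabulate (does ∘ P?)

select⁺ : {P : Fin n → Set} (P? : ∀ i → Dec (P i)) → ∀ {i} → P i → i ∈ select P?
select⁺ P? {i} p = lookup⇒[]= i _ (trans (lookup∘tabulate (does ∘ P?) i) (dec-true (P? i) p))

select⁻ : {P : Fin n → Set} (P? : ∀ i → Dec (P i)) → ∀ {i} → i ∈ select P? → P i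
select⁻ {P = P} P? {i} i∈ = witness (P? i) (trans (sym (lookup∘tabulate (does ∘ P?) i)) ([]=⇒lookup i∈))
  where
  witness : (d : Dec (P i)) → does d ≡ true → P i
  witness (yes p) _ = p

x∈p─q⇒x∉q : ∀ (p q : Subset n) {x} → x ∈ p ─ q → x ∉ q
x∈p─q⇒x∉q (inside ∷ p) (outside ∷ q) here ()
x∈p─q⇒x∉q (_ ∷ p) (_ ∷ q) (there x∈) (there x∈q) = x∈p─q⇒x∉q p q x∈ x∈q

x∈p-y⇒x≢y : ∀ {p : Subset n} {x y} → x ∈ p - y → x ≢ y
x∈p-y⇒x≢y {p = p} {y = y} = x∉⁅y⁆⇒x≢y ∘ x∈p─q⇒x∉q p ⁅ y ⁆

x∈p-y⇒x∈p : ∀ {p : Subset n} {x y} → x ∈ p - y → x ∈ p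
x∈p-y⇒x∈p {p = p} {y = y} = p─q⊆p p ⁅ y ⁆

x∈p∪⁅y⁆⁻ : ∀ {p : Subset n} {x y} → x ∈ p ∪ ⁅ y ⁆ → x ∈ p ⊎ x ≡ y
x∈p∪⁅y⁆⁻ {p = p} {y = y} x∈ = Sum.map₂ (x∈⁅y⁆⇒x≡y y) (x∈p∪q⁻ p ⁅ y ⁆ x∈)

x∈p⇒x∈p∪⁅y⁆ : ∀ {p : Subset n} {x y} → x ∈ p → x ∈ p ∪ ⁅ y ⁆
x∈p⇒x∈p∪⁅y⁆ {y = y} = p⊆p∪q ⁅ y ⁆

y∈p∪⁅y⁆ : ∀ {p : Subset n} {y} → y ∈ p ∪ ⁅ y ⁆
y∈p∪⁅y⁆ {p = p} {y} = q⊆p∪q p ⁅ y ⁆ (x∈⁅x⁆ y)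

∣p∪⁅x⁆∣≡1+∣p∣ : ∀ (p : Subset n) {x} → x ∉ p → ∣ p ∪ ⁅ x ⁆ ∣ ≡ suc ∣ p ∣
∣p∪⁅x⁆∣≡1+∣p∣ (inside  ∷ p) {fzero}  x∉p = contradiction here x∉p
∣p∪⁅x⁆∣≡1+∣p∣ (outside ∷ p) {fzero}  _   = cong (suc ∘ ∣_∣) (∪-identityʳ p)
∣p∪⁅x⁆∣≡1+∣p∣ (inside  ∷ p) {fsuc x} x∉p = cong suc (∣p∪⁅x⁆∣≡1+∣p∣ p (x∉p ∘ there))
∣p∪⁅x⁆∣≡1+∣p∣ (outside ∷ p) {fsuc x} x∉p = ∣p∪⁅x⁆∣≡1+∣p∣ p (x∉p ∘ there)

1+∣p-x∣≡∣p∣ : ∀ (p : Subset n) {x} → x ∈ p → suc ∣ p - x ∣ ≡ ∣ p ∣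
1+∣p-x∣≡∣p∣ (inside  ∷ p) {fzero}  here        = cong (suc ∘ ∣_∣) (p─⊥≡p p)
1+∣p-x∣≡∣p∣ (inside  ∷ p) {fsuc x} (there x∈p) = cong suc (1+∣p-x∣≡∣p∣ p x∈p)
1+∣p-x∣≡∣p∣ (outside ∷ p) {fsuc x} (there x∈p) = 1+∣p-x∣≡∣p∣ p x∈p

∣p-x∪⁅y⁆∣≡∣p∣ : ∀ (p : Subset n) {x y} → x ∈ p → y ∉ p → ∣ (p - x) ∪ ⁅ y ⁆ ∣ ≡ ∣ p ∣
∣p-x∪⁅y⁆∣≡∣p∣ p x∈p y∉p = trans (∣p∪⁅x⁆∣≡1+∣p∣ (p - _) (y∉p ∘ x∈p-y⇒x∈p)) (1+∣p-x∣≡∣p∣ p x∈p)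

nonempty : ∀ (p : Subset n) → 1 ≤ ∣ p ∣ → Nonempty p
nonempty {n} p 1≤∣p∣ with any? (_∈? p)
... | yes x∈p = x∈p
... | no  ∄   = contradiction (subst (1 ≤_) (trans (cong ∣_∣ (Empty-unique ∄)) (∣⊥∣≡0 n)) 1≤∣p∣) λ ()

two-elements : ∀ (p : Subset n) → 2 ≤ ∣ p ∣ → ∃[ x ] ∃[ y ] (x ∈ p × y ∈ p × x ≢ y)
two-elements p 2≤∣p∣ with nonempty p (ℕ.≤-trans (s≤s z≤n) 2≤∣p∣)
... | x , x∈p with nonempty (p - x) (ℕ.≤-pred (subst (2 ≤_) (sym (1+∣p-x∣≡∣p∣ p x∈p)) 2≤∣p∣))
...   | y , y∈p-x = x , y , x∈p , x∈p-y⇒x∈p y∈p-x , x∈p-y⇒x≢y y∈p-x ∘ sym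

∃-missing : ∀ {p q : Subset n} → p ⊆ q → ∣ p ∣ ≢ ∣ q ∣ → ∃[ x ] (x ∈ q × x ∉ p)
∃-missing {p = p} {q} p⊆q ∣p∣≢∣q∣ with any? (λ x → x ∈? q ×-dec ¬? (x ∈? p))
... | yes found = found
... | no  ∄     = contradiction (cong ∣_∣ (⊆-antisym p⊆q q⊆p)) ∣p∣≢∣q∣
  where
  q⊆p : q ⊆ p
  q⊆p {x} x∈q = decidable-stable (x ∈? p) λ x∉p → ∄ (x , x∈q , x∉p)

x∈∁[p∪⁅y⁆]⁺ : ∀ {p : Subset n} {x y} → x ∉ p → x ≢ y → x ∈ ∁ (p ∪ ⁅ y ⁆)
x∈∁[p∪⁅y⁆]⁺ x∉p x≢y = x∉p⇒x∈∁p ([ x∉p , x≢y ]′ ∘ x∈p∪⁅y⁆⁻)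

x∈∁[p∪⁅y⁆]⁻ : ∀ {p : Subset n} {x y} → x ∈ ∁ (p ∪ ⁅ y ⁆) → x ∉ p × x ≢ y
x∈∁[p∪⁅y⁆]⁻ x∈ = x∈∁p⇒x∉p x∈ ∘ x∈p⇒x∈p∪⁅y⁆ , λ { refl → x∈∁p⇒x∉p x∈ y∈p∪⁅y⁆ }

p∪⁅y⁆⊆q : ∀ {p q : Subset n} {y} → p ⊆ q → y ∈ q → p ∪ ⁅ y ⁆ ⊆ q
p∪⁅y⁆⊆q p⊆q y∈q = [ p⊆q , (λ { refl → y∈q }) ]′ ∘ x∈p∪⁅y⁆⁻

⁅x⁆⊆∁p : ∀ {p : Subset n} {x} → x ∉ p → ⁅ x ⁆ ⊆ ∁ p
⁅x⁆⊆∁p {x = x} x∉p y∈⁅x⁆ rewrite x∈⁅y⁆⇒x≡y x y∈⁅x⁆ = x∉p⇒x∈∁p x∉p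

∣∁[p∪⁅x⁆]∣<∣∁p∣ : ∀ {p : Subset n} {x} → x ∉ p → ∣ ∁ (p ∪ ⁅ x ⁆) ∣ < ∣ ∁ p ∣
∣∁[p∪⁅x⁆]∣<∣∁p∣ {p = p} {x} x∉p = p⊂q⇒∣p∣<∣q∣ (p⊂q⇒∁p⊃∁q (p⊆p∪q ⁅ x ⁆ , x , y∈p∪⁅y⁆ , x∉p))

Consecutive : ℕ → ℕ → Set
Consecutive i j = suc i ≡ j ⊎ suc j ≡ i

Consecutive-suc : ∀ {i j} → Consecutive (suc i) (suc j) ⇔ Consecutive i j
Consecutive-suc = mk⇔ (Sum.map ℕ.suc-injective ℕ.suc-injective) (Sum.map (cong suc) (cong suc))

Consecutive-+ : ∀ j {i i′} → Consecutive (j + i) (j + i′) ⇔ Consecutive i i′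
Consecutive-+ zero    = ⇔.refl
Consecutive-+ (suc j) = ⇔.trans Consecutive-suc (Consecutive-+ j)

infixr 5 _◂_
_◂_ : ∀ {A : Set} → A → (ℕ → A) → ℕ → A
(a ◂ q) zero    = a
(a ◂ q) (suc i) = q i

last-index : ∀ {P : ℕ → Set} → (∀ k → Dec (P k)) → ∀ {m j} → j ≤ m → P j
           → ∃[ i ] (i ≤ m × P i × (∀ {k} → i < k → k ≤ m → ¬ P k))
last-index P? {zero} z≤n pj = 0 , z≤n , pj , λ 0<k k≤0 → contradiction (ℕ.<-≤-trans 0<k k≤0) λ ()
last-index P? {suc m} j≤1+m pj with P? (suc m)
... | yes pm = suc m , ℕ.≤-refl , pm , λ m<k k≤m → contradiction k≤m (ℕ.<⇒≱ m<k)
... | no ¬pm with ℕ.m≤n⇒m<n∨m≡n j≤1+m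
...   | inj₂ refl = contradiction pj ¬pm
...   | inj₁ j<1+m with last-index P? (ℕ.≤-pred j<1+m) pj
...     | i , i≤m , pi , after = i , ℕ.m≤n⇒m≤1+n i≤m , pi , λ i<k k≤1+m →
          [ after i<k ∘ ℕ.≤-pred , (λ { refl → ¬pm }) ]′ (ℕ.m≤n⇒m<n∨m≡n k≤1+m)

-- Positions on a cycle 0, 1, …, m, m + 1 obtained from a path 0, …, m and an apex.
data Position (m : ℕ) : ℕ → Set where
  path : ∀ {t} → t ≤ m → Position m t
  apex : Position m (suc m)

position : ∀ {m t} → t < 2 + m → Position m t
position (s≤s t≤1+m) with ℕ.m≤n⇒m<n∨m≡n t≤1+m
... | inj₁ (s≤s t≤m) = path t≤m
... | inj₂ refl      = apex

-- CycNeighbour (2 + m), on the underlying naturals.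
Around : ℕ → ℕ → ℕ → Set
Around m s t = suc s ≡ t ⊎ suc t ≡ s ⊎ ((s ≡ 0 × suc t ≡ 2 + m) ⊎ (t ≡ 0 × suc s ≡ 2 + m))

Around-sym : ∀ {m s t} → Around m s t → Around m t s
Around-sym (inj₁ e)        = inj₂ (inj₁ e)
Around-sym (inj₂ (inj₁ e)) = inj₁ e
Around-sym (inj₂ (inj₂ w)) = inj₂ (inj₂ (Sum.swap w))

Around-path : ∀ {m s t} → s ≤ m → t ≤ m → Consecutive s t ⇔ Around m s t
Around-path {m} s≤m t≤m = mk⇔ [ inj₁ , inj₂ ∘ inj₁ ]′ λ
  { (inj₁ e)                     → inj₁ e
  ; (inj₂ (inj₁ e))              → inj₂ e
  ; (inj₂ (inj₂ (inj₁ (_ , e)))) → contradiction e (below-apex t≤m)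
  ; (inj₂ (inj₂ (inj₂ (_ , e)))) → contradiction e (below-apex s≤m)
  }
  where
  below-apex : ∀ {t} → t ≤ m → suc t ≢ 2 + m
  below-apex t≤m e = ℕ.1+n≰n (subst (_≤ m) (ℕ.suc-injective e) t≤m)

Around-apex : ∀ {m s} → s ≤ m → (s ≡ 0 ⊎ s ≡ m) ⇔ Around m s (suc m)
Around-apex {m} s≤m = mk⇔ [ (λ s≡0 → inj₂ (inj₂ (inj₁ (s≡0 , refl)))) , inj₁ ∘ cong suc ]′ λ
  { (inj₁ e)                       → inj₂ (ℕ.suc-injective e)
  ; (inj₂ (inj₁ e))                → contradiction (ℕ.≤-trans (ℕ.n≤1+n _) (subst (_≤ m) (sym e) s≤m)) ℕ.1+n≰n
  ; (inj₂ (inj₂ (inj₁ (s≡0 , _)))) → inj₁ s≡0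
  ; (inj₂ (inj₂ (inj₂ (() , _))))
  }

¬Around-apex-apex : ∀ {m} → ¬ Around m (suc m) (suc m)
¬Around-apex-apex (inj₁ e)                     = ℕ.1+n≢n e
¬Around-apex-apex (inj₂ (inj₁ e))              = ℕ.1+n≢n e
¬Around-apex-apex (inj₂ (inj₂ (inj₁ (() , _))))
¬Around-apex-apex (inj₂ (inj₂ (inj₂ (() , _))))

-- Graphs, walks and connectivity

Adj-complement⁺ : ∀ {G : Graph n} {i j} → i ≢ j → ¬ Adj G i j → Adj (complement G) i j
Adj-complement⁺ {i = i} {j} i≢j ¬i~j with i ≟ j
... | yes i≡j = contradiction i≡j i≢j
... | no  _   rewrite Bool.¬-not ¬i~j = refl

Adj-complement⁻ : ∀ {G : Graph n} {i j} → Adj (complement G) i j → ¬ Adj G i j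
Adj-complement⁻ {i = i} {j} i~j with i ≟ j
Adj-complement⁻ ()  | yes _
Adj-complement⁻ i~j | no  _ = λ i~Gj → contradiction (trans (cong Bool.not (sym i~Gj)) i~j) λ ()

module Graphs {n : ℕ} (K : Graph n) where

  Adj-sym : ∀ {i j} → Adj K i j → Adj K j i
  Adj-sym {i} {j} i~j = trans (Graph.sym K j i) i~j

  Adj-irrefl : ∀ {i} → ¬ Adj K i i
  Adj-irrefl {i} i~i with trans (sym (irrefl K i)) i~i
  ... | ()

  Adj⇒≢ : ∀ {i j} → Adj K i j → i ≢ j
  Adj⇒≢ i~i refl = Adj-irrefl i~i

  Adj-sym⇔ : ∀ {i j} → Adj K i j ⇔ Adj K j i
  Adj-sym⇔ = mk⇔ Adj-sym Adj-sym

  Adj? : ∀ i j → Dec (Adj K i j)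
  Adj? i j = Bool._≟_ (adj K i j) true

  WalkIn-mono : ∀ {W W′ u v} → W ⊆ W′ → WalkIn K W u v → WalkIn K W′ u v
  WalkIn-mono W⊆W′ here            = here
  WalkIn-mono W⊆W′ (step u~w w∈W p) = step u~w (W⊆W′ w∈W) (WalkIn-mono W⊆W′ p)

  infixr 5 _++_
  _++_ : ∀ {W u v w} → WalkIn K W u v → WalkIn K W v w → WalkIn K W u w
  here             ++ q = q
  step u~w w∈W p ++ q = step u~w w∈W (p ++ q)

  _▷_∣_ : ∀ {W u v w} → WalkIn K W u v → Adj K v w → w ∈ W → WalkIn K W u w
  p ▷ v~w ∣ w∈W = p ++ step v~w w∈W here

  reverse : ∀ {W u v} → u ∈ W → WalkIn K W u v → WalkIn K W v u
  reverse u∈W here             = here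
  reverse u∈W (step u~w w∈W p) = reverse w∈W p ▷ Adj-sym u~w ∣ u∈W

  -- Cutting the walk at its last visit of w.
  avoid-or-restart : ∀ {W u v} → WalkIn K W u v → ∀ w → WalkIn K (W - w) u v ⊎ WalkIn K (W - w) w v
  avoid-or-restart here w = inj₁ here
  avoid-or-restart (step {w = x} u~x x∈W p) w with avoid-or-restart p w | x ≟ w
  ... | inj₂ q | _        = inj₂ q
  ... | inj₁ q | yes refl = inj₂ q
  ... | inj₁ q | no x≢w   = inj₁ (step u~x (x∈p∧x≢y⇒x∈p-y x∈W x≢w) q)

  first-step : ∀ {W u v} → WalkIn K W u v → u ≡ v ⊎ ∃[ w ] (Adj K u w × w ∈ W × WalkIn K (W - w) w v)
  first-step here = inj₁ refl
  first-step (step {w = w} u~w w∈W p) = inj₂ (w , u~w , w∈W , [ id , id ]′ (avoid-or-restart p w))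

  walk? : ∀ W u v → Dec (WalkIn K W u v)
  walk? W = go W (ℕ.<-wellFounded ∣ W ∣)
    where
    go : ∀ W → Acc _<_ ∣ W ∣ → ∀ u v → Dec (WalkIn K W u v)
    go W (acc rec) u v with u ≟ v
    ... | yes refl = yes here
    ... | no  u≢v  = map′ from to (any? λ w → Adj? u w ×-dec continue? w)
      where
      continue? : ∀ w → Dec (w ∈ W × WalkIn K (W - w) w v)
      continue? w with w ∈? W
      ... | yes w∈W = map′ (w∈W ,_) proj₂ (go (W - w) (rec (x∈p⇒∣p-x∣<∣p∣ w∈W)) w v)
      ... | no  w∉W = no (w∉W ∘ proj₁)
      from : ∃[ w ] (Adj K u w × w ∈ W × WalkIn K (W - w) w v) → WalkIn K W u v
      from (w , u~w , w∈W , p) = step u~w w∈W (WalkIn-mono x∈p-y⇒x∈p p)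
      to : WalkIn K W u v → ∃[ w ] (Adj K u w × w ∈ W × WalkIn K (W - w) w v)
      to p = [ (λ u≡v → contradiction u≡v u≢v) , id ]′ (first-step p)

  end-∈ : ∀ {W u v} → u ∈ W → WalkIn K W u v → v ∈ W
  end-∈ u∈W here             = u∈W
  end-∈ u∈W (step _ w∈W p) = end-∈ w∈W p

  connected-subsingleton : ∀ {W} → (∀ {u v} → u ∈ W → v ∈ W → u ≡ v) → InducedConnected K W
  connected-subsingleton {W} unique u v u∈W v∈W = subst (WalkIn K W u) (unique u∈W v∈W) here

  connected-edge : ∀ {W} → InducedConnected K W → 2 ≤ ∣ W ∣ → ∃[ a ] ∃[ c ] (a ∈ W × c ∈ W × Adj K a c)
  connected-edge {W} W-conn 2≤∣W∣ with two-elements W 2≤∣W∣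
  ... | a , b , a∈W , b∈W , a≢b with first-step (W-conn a b a∈W b∈W)
  ...   | inj₁ a≡b                  = contradiction a≡b a≢b
  ...   | inj₂ (c , a~c , c∈W , _) = a , c , a∈W , c∈W , a~c

  connected? : ∀ W → Dec (InducedConnected K W)
  connected? W = all? λ u → all? λ v → u ∈? W →-dec (v ∈? W →-dec walk? W u v)

  connected-∪⁅⁆ : ∀ {A s y} → InducedConnected K A → s ∈ A → Adj K s y → InducedConnected K (A ∪ ⁅ y ⁆)
  connected-∪⁅⁆ {A} {s} {y} A-conn s∈A s~y u v u∈ v∈ = reverse (x∈p⇒x∈p∪⁅y⁆ s∈A) (from-s u∈) ++ from-s v∈
    where
    from-s : ∀ {u} → u ∈ A ∪ ⁅ y ⁆ → WalkIn K (A ∪ ⁅ y ⁆) s u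
    from-s u∈ with x∈p∪⁅y⁆⁻ u∈
    ... | inj₁ u∈A  = WalkIn-mono x∈p⇒x∈p∪⁅y⁆ (A-conn s _ s∈A u∈A)
    ... | inj₂ refl = step s~y y∈p∪⁅y⁆ here

  leaving-edge : ∀ {W S a b} → WalkIn K W a b → a ∈ S → b ∉ S → ∃[ u ] ∃[ v ] (u ∈ S × v ∈ W × v ∉ S × Adj K u v)
  leaving-edge here a∈S b∉S = contradiction a∈S b∉S
  leaving-edge {S = S} (step {w = w} a~w w∈W p) a∈S b∉S with w ∈? S
  ... | yes w∈S = leaving-edge p w∈S b∉S
  ... | no  w∉S = _ , w , a∈S , w∈W , w∉S , a~w

  -- Grow S along leaving edges; once W = S ∪ ⁅ v ⁆, removing v leaves the connected S.
  non-cut-vertex : ∀ {S W s w} → InducedConnected K S → S ⊆ W → InducedConnected K W → s ∈ S → w ∈ W → w ∉ S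
                 → ∃[ z ] (z ∈ W × z ∉ S × InducedConnected K (W - z))
  non-cut-vertex {S} = go S (ℕ.<-wellFounded ∣ ∁ S ∣)
    where
    go : ∀ S → Acc _<_ ∣ ∁ S ∣ → ∀ {W s w} → InducedConnected K S → S ⊆ W → InducedConnected K W → s ∈ S → w ∈ W → w ∉ S
       → ∃[ z ] (z ∈ W × z ∉ S × InducedConnected K (W - z))
    go S (acc rec) {W} S-conn S⊆W W-conn s∈S w∈W w∉S
      with leaving-edge (W-conn _ _ (S⊆W s∈S) w∈W) s∈S w∉S
    ... | u , v , u∈S , v∈W , v∉S , u~v with any? (λ x → x ∈? W ×-dec ¬? (x ∈? S ∪ ⁅ v ⁆))
    ...   | no ∄ = v , v∈W , v∉S , λ x y x∈ y∈ → WalkIn-mono S⊆W-v (S-conn x y (W-v⊆S x∈) (W-v⊆S y∈))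
      where
      S⊆W-v : S ⊆ W - v
      S⊆W-v x∈S = x∈p∧x≢y⇒x∈p-y (S⊆W x∈S) λ { refl → v∉S x∈S }
      W-v⊆S : W - v ⊆ S
      W-v⊆S {x} x∈ = decidable-stable (x ∈? S) λ x∉S →
        ∄ (x , x∈p-y⇒x∈p x∈ , [ x∉S , x∈p-y⇒x≢y x∈ ]′ ∘ x∈p∪⁅y⁆⁻)
    ...   | yes (w′ , w′∈W , w′∉S∪v) with go (S ∪ ⁅ v ⁆) (rec (∣∁[p∪⁅x⁆]∣<∣∁p∣ v∉S)) (connected-∪⁅⁆ S-conn u∈S u~v)
                                            (λ x∈ → [ S⊆W , (λ { refl → v∈W }) ]′ (x∈p∪⁅y⁆⁻ x∈))
                                            W-conn (x∈p⇒x∈p∪⁅y⁆ s∈S) w′∈W w′∉S∪v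
    ...     | z , z∈W , z∉S∪v , W-z-conn = z , z∈W , z∉S∪v ∘ x∈p⇒x∈p∪⁅y⁆ , W-z-conn

  exchange : ∀ {S W s w y} → InducedConnected K S → S ⊆ W → InducedConnected K W → s ∈ S → Adj K s y → w ∈ W → w ∉ S
           → ∃[ z ] (z ∈ W × z ∉ S × InducedConnected K ((W - z) ∪ ⁅ y ⁆))
  exchange S-conn S⊆W W-conn s∈S s~y w∈W w∉S with non-cut-vertex S-conn S⊆W W-conn s∈S w∈W w∉S
  ... | z , z∈W , z∉S , W-z-conn =
    z , z∈W , z∉S , connected-∪⁅⁆ W-z-conn (x∈p∧x≢y⇒x∈p-y (S⊆W s∈S) λ { refl → z∉S s∈S }) s~y

  exchange-⁅⁆ : ∀ {W w o y} → InducedConnected K W → w ∈ W → o ∈ W → o ≢ w → Adj K w y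
              → ∃[ z ] (z ∈ W × InducedConnected K ((W - z) ∪ ⁅ y ⁆))
  exchange-⁅⁆ {w = w} W-conn w∈W o∈W o≢w w~y
    with exchange (connected-subsingleton λ u∈ v∈ → trans (x∈⁅y⁆⇒x≡y w u∈) (sym (x∈⁅y⁆⇒x≡y w v∈)))
                  (λ u∈⁅w⁆ → subst (_∈ _) (sym (x∈⁅y⁆⇒x≡y w u∈⁅w⁆)) w∈W) W-conn (x∈⁅x⁆ w) w~y o∈W (o≢w ∘ x∈⁅y⁆⇒x≡y w)
  ... | z , z∈W , _ , conn = z , z∈W , conn

  record InducedPath (p : ℕ → Fin n) (m : ℕ) : Set where
    field
      adjacent  : ∀ {i j} → i ≤ m → j ≤ m → Adj K (p i) (p j) ⇔ Consecutive i j
      injective : ∀ {i j} → i ≤ m → j ≤ m → p i ≡ p j → i ≡ j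

  suffix : ∀ {p m} j {d} → j + d ≡ m → InducedPath p m → InducedPath (λ i → p (j + i)) d
  suffix {p} j {d} j+d≡m P = record
    { adjacent  = λ i≤d i′≤d → ⇔.trans (adjacent (shift i≤d) (shift i′≤d)) (Consecutive-+ j)
    ; injective = λ i≤d i′≤d eq → ℕ.+-cancelˡ-≡ j _ _ (injective (shift i≤d) (shift i′≤d) eq)
    }
    where
    open InducedPath P
    shift : ∀ {i} → i ≤ d → j + i ≤ _
    shift {i} i≤d = subst (j + i ≤_) j+d≡m (ℕ.+-monoʳ-≤ j i≤d)

  prepend : ∀ {a q d} → InducedPath q d → (∀ {i} → i ≤ d → Adj K a (q i) ⇔ i ≡ 0) → (∀ {i} → i ≤ d → a ≢ q i)
          → InducedPath (a ◂ q) (suc d)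
  prepend {a} {q} {d} Q a~q a≢q = record { adjacent = adjacent′ ; injective = injective′ }
    where
    open InducedPath Q
    adjacent′ : ∀ {i j} → i ≤ suc d → j ≤ suc d → Adj K ((a ◂ q) i) ((a ◂ q) j) ⇔ Consecutive i j
    adjacent′ {zero}  {zero}  _   _   = mk⇔ (λ a~a → contradiction a~a Adj-irrefl) λ { (inj₁ ()) ; (inj₂ ()) }
    adjacent′ {zero}  {suc j} _   j≤d = ⇔.trans (a~q (ℕ.≤-pred j≤d)) (mk⇔ (inj₁ ∘ cong suc ∘ sym) λ { (inj₁ refl) → refl })
    adjacent′ {suc i} {zero}  i≤d _   = ⇔.trans Adj-sym⇔
      (⇔.trans (a~q (ℕ.≤-pred i≤d)) (mk⇔ (inj₂ ∘ cong suc ∘ sym) λ { (inj₂ refl) → refl }))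
    adjacent′ {suc i} {suc j} i≤d j≤d = ⇔.trans (adjacent (ℕ.≤-pred i≤d) (ℕ.≤-pred j≤d)) (⇔.sym Consecutive-suc)
    injective′ : ∀ {i j} → i ≤ suc d → j ≤ suc d → (a ◂ q) i ≡ (a ◂ q) j → i ≡ j
    injective′ {zero}  {zero}  _   _   _  = refl
    injective′ {zero}  {suc j} _   j≤d eq = contradiction eq (a≢q (ℕ.≤-pred j≤d))
    injective′ {suc i} {zero}  i≤d _   eq = contradiction (sym eq) (a≢q (ℕ.≤-pred i≤d))
    injective′ {suc i} {suc j} i≤d j≤d eq = cong suc (injective (ℕ.≤-pred i≤d) (ℕ.≤-pred j≤d) eq)

  record InducedPathIn (P : Subset n) (a b : Fin n) : Set where
    field
      length  : ℕ
      vertex  : ℕ → Fin n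
      induced : InducedPath vertex length
      start   : vertex 0 ≡ a
      end     : vertex length ≡ b
      within  : ∀ {i} → i ≤ length → vertex i ≡ a ⊎ vertex i ∈ P

  -- Shortcut from a to the last vertex of the path that is a or adjacent to a.
  extend : ∀ {P a w b} → Adj K a w → w ∈ P → InducedPathIn P w b → InducedPathIn P a b
  extend {P} {a} {w} {b} a~w w∈P Q = shortcut-at (last-index Near? z≤n (inj₂ (subst (Adj K a) (sym start) a~w)))
    where
    open InducedPathIn Q
    Near : ℕ → Set
    Near k = vertex k ≡ a ⊎ Adj K a (vertex k)
    Near? : ∀ k → Dec (Near k)
    Near? k = (vertex k ≟ a) ⊎-dec Adj? a (vertex k)
    shortcut-at : ∃[ i ] (i ≤ length × Near i × (∀ {k} → i < k → k ≤ length → ¬ Near k)) → InducedPathIn P a b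
    shortcut-at (i , i≤m , near , after) = shortcut near
      where
      d : ℕ
      d = proj₁ (ℕ.m≤n⇒∃[o]m+o≡n i≤m)
      i+d≡m : i + d ≡ length
      i+d≡m = proj₂ (ℕ.m≤n⇒∃[o]m+o≡n i≤m)
      q : ℕ → Fin n
      q k = vertex (i + k)
      shift : ∀ {k} → k ≤ d → i + k ≤ length
      shift {k} k≤d = subst (i + k ≤_) i+d≡m (ℕ.+-monoʳ-≤ i k≤d)
      q∈P : ∀ {k} → k ≤ d → q k ∈ P
      q∈P k≤d = [ (λ eq → subst (_∈ P) (sym eq) w∈P) , id ]′ (within (shift k≤d))
      q0 : q 0 ≡ vertex i
      q0 = cong vertex (ℕ.+-identityʳ i)
      far : ∀ {k} → suc k ≤ d → ¬ Near (i + suc k)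
      far k<d = after (ℕ.m<m+n i (s≤s z≤n)) (shift k<d)
      shortcut : Near i → InducedPathIn P a b
      shortcut (inj₁ vi≡a) = record
        { length  = d
        ; vertex  = q
        ; induced = suffix i i+d≡m induced
        ; start   = trans q0 vi≡a
        ; end     = trans (cong vertex i+d≡m) end
        ; within  = inj₂ ∘ q∈P
        }
      shortcut (inj₂ a~vi) = record
        { length  = suc d
        ; vertex  = a ◂ q
        ; induced = prepend (suffix i i+d≡m induced) a~q a≢q
        ; start   = refl
        ; end     = trans (cong vertex i+d≡m) end
        ; within  = λ { {zero} _ → inj₁ refl ; {suc k} k<1+d → inj₂ (q∈P (ℕ.≤-pred k<1+d)) }
        }
        where
        a~q : ∀ {k} → k ≤ d → Adj K a (q k) ⇔ k ≡ 0
        a~q {zero}  _   = mk⇔ (λ _ → refl) (λ _ → subst (Adj K a) (sym q0) a~vi)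
        a~q {suc k} k<d = mk⇔ (λ a~ → contradiction (inj₂ a~) (far k<d)) λ ()
        a≢q : ∀ {k} → k ≤ d → a ≢ q k
        a≢q {zero}  _   a≡q0 = Adj⇒≢ a~vi (trans a≡q0 q0)
        a≢q {suc k} k<d a≡q  = far k<d (inj₁ (sym a≡q))

  induced-path : ∀ {P a b} → WalkIn K P a b → InducedPathIn P a b
  induced-path {a = a} here = record
    { length  = 0
    ; vertex  = λ _ → a
    ; induced = record
      { adjacent  = λ { z≤n z≤n → mk⇔ (λ a~a → contradiction a~a Adj-irrefl) λ { (inj₁ ()) ; (inj₂ ()) } }
      ; injective = λ { z≤n z≤n _ → refl }
      }
    ; start   = refl
    ; end     = refl
    ; within  = λ _ → inj₁ refl
    }
  induced-path (step a~w w∈P walk) = extend a~w w∈P (induced-path walk)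

  close-cycle : ∀ {p m v} → InducedPath p m → (∀ {i} → i ≤ m → v ≢ p i)
              → (∀ {i} → i ≤ m → Adj K v (p i) ⇔ (i ≡ 0 ⊎ i ≡ m)) → InducedCycle K (2 + m)
  close-cycle {p} {m} {v} P v≢p v~p =
      (λ i → vertex (position (toℕ<n i)))
    , (λ {i} {j} eq → toℕ-injective (injective-at (position (toℕ<n i)) (position (toℕ<n j)) eq))
    , (λ i j → adjacent-at (position (toℕ<n i)) (position (toℕ<n j)))
    where
    open InducedPath P
    vertex : ∀ {t} → Position m t → Fin n
    vertex {t} (path _) = p t
    vertex apex         = v

    adjacent-at : ∀ {s t} (x : Position m s) (y : Position m t) → Adj K (vertex x) (vertex y) ⇔ Around m s t
    adjacent-at (path s≤m) (path t≤m) = ⇔.trans (adjacent s≤m t≤m) (Around-path s≤m t≤m)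
    adjacent-at (path s≤m) apex       = ⇔.trans Adj-sym⇔ (⇔.trans (v~p s≤m) (Around-apex s≤m))
    adjacent-at apex       (path t≤m) = ⇔.trans Adj-sym⇔ (⇔.trans (adjacent-at (path t≤m) apex) (mk⇔ Around-sym Around-sym))
    adjacent-at apex       apex       = mk⇔ (λ v~v → contradiction v~v Adj-irrefl) (λ around → contradiction around ¬Around-apex-apex)

    injective-at : ∀ {s t} (x : Position m s) (y : Position m t) → vertex x ≡ vertex y → s ≡ t
    injective-at (path s≤m) (path t≤m) eq = injective s≤m t≤m eq
    injective-at (path s≤m) apex       eq = contradiction (sym eq) (v≢p s≤m)
    injective-at apex       (path t≤m) eq = contradiction eq (v≢p t≤m)
    injective-at apex       apex       _  = refl

  apex-path-length≤1 : Chordal K → ∀ {p m v} → InducedPath p m → (∀ {i} → i ≤ m → v ≢ p i)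
                     → (∀ {i} → i ≤ m → Adj K v (p i) ⇔ (i ≡ 0 ⊎ i ≡ m)) → m ≤ 1
  apex-path-length≤1 chordal {m = zero}        _ _   _   = z≤n
  apex-path-length≤1 chordal {m = suc zero}    _ _   _   = ℕ.≤-refl
  apex-path-length≤1 chordal {m = suc (suc m)} P v≢p v~p = contradiction (close-cycle P v≢p v~p) (chordal (4 + m) (ℕ.m≤m+n 4 m))

  -- The walk is shortened to an induced path; closing it up through v would give a long induced cycle.
  adjacent-via-far-walk : Chordal K → ∀ {R v s₁ s₂} → (∀ {i} → i ∈ R → i ≢ v × ¬ Adj K v i)
                        → Adj K v s₁ → Adj K v s₂ → s₁ ≢ s₂ → WalkIn K (R ∪ ⁅ s₂ ⁆) s₁ s₂ → Adj K s₁ s₂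
  adjacent-via-far-walk chordal {R} {v} {s₁} {s₂} far v~s₁ v~s₂ s₁≢s₂ walk =
    by-length (ℕ.m≤n⇒m<n∨m≡n (apex-path-length≤1 chordal induced v≢p v~p))
    where
    open InducedPathIn (induced-path walk)
    end-or-far : ∀ {i} → i ≤ length → (i ≡ 0 ⊎ i ≡ length) ⊎ vertex i ∈ R
    end-or-far i≤ℓ with within i≤ℓ
    ... | inj₁ vi≡s₁ = inj₁ (inj₁ (InducedPath.injective induced i≤ℓ z≤n (trans vi≡s₁ (sym start))))
    ... | inj₂ vi∈R∪s₂ with x∈p∪⁅y⁆⁻ vi∈R∪s₂
    ...   | inj₁ vi∈R  = inj₂ vi∈R
    ...   | inj₂ vi≡s₂ = inj₁ (inj₂ (InducedPath.injective induced i≤ℓ ℕ.≤-refl (trans vi≡s₂ (sym end))))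
    v~end : ∀ {i} → i ≡ 0 ⊎ i ≡ length → Adj K v (vertex i)
    v~end (inj₁ refl) = subst (Adj K v) (sym start) v~s₁
    v~end (inj₂ refl) = subst (Adj K v) (sym end) v~s₂
    v≢p : ∀ {i} → i ≤ length → v ≢ vertex i
    v≢p i≤ℓ with end-or-far i≤ℓ
    ... | inj₁ i-end = Adj⇒≢ (v~end i-end)
    ... | inj₂ vi∈R  = proj₁ (far vi∈R) ∘ sym
    v~p : ∀ {i} → i ≤ length → Adj K v (vertex i) ⇔ (i ≡ 0 ⊎ i ≡ length)
    v~p i≤ℓ = mk⇔ (λ v~vi → [ id , (λ vi∈R → contradiction v~vi (proj₂ (far vi∈R))) ]′ (end-or-far i≤ℓ)) v~end
    by-length : length < 1 ⊎ length ≡ 1 → Adj K s₁ s₂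
    by-length (inj₁ ℓ<1) = contradiction (trans (sym start) (trans (cong vertex (sym (ℕ.n<1⇒n≡0 ℓ<1))) end)) s₁≢s₂
    by-length (inj₂ ℓ≡1) =
      subst₂ (Adj K) start end (Equivalence.from (InducedPath.adjacent induced z≤n ℕ.≤-refl) (inj₁ (sym ℓ≡1)))

  -- Simplicial vertices of chordal graphs

  Clique : Subset n → Set
  Clique X = ∀ {a b} → a ∈ X → b ∈ X → a ≢ b → Adj K a b

  Simplicial : Subset n → Fin n → Set
  Simplicial U x = x ∈ U × (∀ {a b} → a ∈ U → b ∈ U → Adj K x a → Adj K x b → a ≢ b → Adj K a b)

  Simplicial-lift : ∀ {U′ U x} → U′ ⊆ U → (∀ {y} → y ∈ U → Adj K x y → y ∈ U′) → Simplicial U′ x → Simplicial U x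
  Simplicial-lift U′⊆U closed (x∈U′ , simp) =
    U′⊆U x∈U′ , λ a∈U b∈U x~a x~b → simp (closed a∈U x~a) (closed b∈U x~b) x~a x~b

  Simplicial-insert-universal : ∀ {U v x} → (∀ {y} → y ∈ U → y ≢ v → Adj K v y) → Simplicial (U - v) x → Simplicial U x
  Simplicial-insert-universal {U} {v} universal (x∈U-v , simp) = x∈p-y⇒x∈p x∈U-v , simp′
    where
    simp′ : ∀ {a b} → a ∈ U → b ∈ U → Adj K _ a → Adj K _ b → a ≢ b → Adj K a b
    simp′ {a} {b} a∈U b∈U x~a x~b a≢b with a ≟ v | b ≟ v
    ... | yes refl | _        = universal b∈U (a≢b ∘ sym)
    ... | no  _    | yes refl = Adj-sym (universal a∈U a≢b)
    ... | no  a≢v  | no  b≢v  = simp (x∈p∧x≢y⇒x∈p-y a∈U a≢v) (x∈p∧x≢y⇒x∈p-y b∈U b≢v) x~a x~b a≢b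

  SimplicialOutside : Subset n → Set
  SimplicialOutside U = ∀ {X a} → Clique X → X ⊆ U → a ∈ U → a ∉ X → ∃[ x ] (Simplicial U x × x ∉ X)

  module SimplicialStep (chordal : Chordal K) {U} (IH : ∀ {U′} → ∣ U′ ∣ < ∣ U ∣ → SimplicialOutside U′)
                        {X} (clique : Clique X) (X⊆U : X ⊆ U)
                        {v} (v∈U : v ∈ U) (X⊆N[v] : ∀ {x} → x ∈ X → x ≢ v → Adj K v x) where

    Far : Fin n → Set
    Far i = i ≢ v × ¬ Adj K v i

    Far? : ∀ i → Dec (Far i)
    Far? i = ¬? (i ≟ v) ×-dec ¬? (Adj? v i)

    R? : ∀ i → Dec (i ∈ U × Far i)
    R? i = i ∈? U ×-dec Far? i

    R : Subset n
    R = select R?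

    R-far : ∀ {i} → i ∈ R → Far i
    R-far = proj₂ ∘ select⁻ R?

    R⊆U : R ⊆ U
    R⊆U = proj₁ ∘ select⁻ R?

    -- Sep separates the component C of c₀ in U ∖ N[v] from v, and is a clique by chordality.
    module Component {c₀} (c₀∈R : c₀ ∈ R) where

      C : Subset n
      C = select (walk? R c₀)

      walk-to : ∀ {c} → c ∈ C → WalkIn K R c₀ c
      walk-to = select⁻ (walk? R c₀)

      C⊆R : C ⊆ R
      C⊆R = end-∈ c₀∈R ∘ walk-to

      c₀∈C : c₀ ∈ C
      c₀∈C = select⁺ (walk? R c₀) here

      Sep? : ∀ s → Dec (s ∈ U × s ∉ C × ∃[ c ] (c ∈ C × Adj K s c))
      Sep? s = s ∈? U ×-dec ¬? (s ∈? C) ×-dec any? (λ c → c ∈? C ×-dec Adj? s c)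

      Sep : Subset n
      Sep = select Sep?

      Sep⊆N[v] : ∀ {s} → s ∈ Sep → Adj K v s
      Sep⊆N[v] {s} s∈Sep with select⁻ Sep? s∈Sep
      ... | s∈U , s∉C , c , c∈C , s~c = decidable-stable (Adj? v s) λ ¬v~s →
        s∉C (select⁺ (walk? R c₀) (walk-to c∈C ▷ Adj-sym s~c ∣ select⁺ R? (s∈U , s≢v , ¬v~s)))
        where
        s≢v : s ≢ v
        s≢v refl = proj₂ (R-far (C⊆R c∈C)) s~c

      Sep-clique : Clique Sep
      Sep-clique {s₁} {s₂} s₁∈Sep s₂∈Sep s₁≢s₂ with select⁻ Sep? s₁∈Sep | select⁻ Sep? s₂∈Sep
      ... | _ , _ , c₁ , c₁∈C , s₁~c₁ | _ , _ , c₂ , c₂∈C , s₂~c₂ =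
        adjacent-via-far-walk chordal R-far (Sep⊆N[v] s₁∈Sep) (Sep⊆N[v] s₂∈Sep) s₁≢s₂
          (step s₁~c₁ (x∈p⇒x∈p∪⁅y⁆ (C⊆R c₁∈C))
            (WalkIn-mono x∈p⇒x∈p∪⁅y⁆ (reverse c₀∈R (walk-to c₁∈C) ++ walk-to c₂∈C) ▷ Adj-sym s₂~c₂ ∣ y∈p∪⁅y⁆))

      U′ : Subset n
      U′ = C ∪ Sep

      U′⊂U : U′ ⊂ U
      U′⊂U = (λ x∈ → [ R⊆U ∘ C⊆R , proj₁ ∘ select⁻ Sep? ]′ (x∈p∪q⁻ C Sep x∈)) , v , v∈U , λ v∈U′ →
        [ (λ v∈C → proj₁ (R-far (C⊆R v∈C)) refl) , (λ v∈Sep → Adj-irrefl (Sep⊆N[v] v∈Sep)) ]′ (x∈p∪q⁻ C Sep v∈U′)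

      c₀∉Sep : c₀ ∉ Sep
      c₀∉Sep c₀∈Sep = proj₁ (proj₂ (select⁻ Sep? c₀∈Sep)) c₀∈C

      lift : ∃[ x ] (Simplicial U′ x × x ∉ Sep) → ∃[ x ] (Simplicial U x × x ∉ X)
      lift (x , simp , x∉Sep) = x , Simplicial-lift (proj₁ U′⊂U) closed simp , x∉X
        where
        x∈C : x ∈ C
        x∈C = [ id , (λ x∈Sep → contradiction x∈Sep x∉Sep) ]′ (x∈p∪q⁻ C Sep (proj₁ simp))
        closed : ∀ {y} → y ∈ U → Adj K x y → y ∈ U′
        closed {y} y∈U x~y with y ∈? C
        ... | yes y∈C = p⊆p∪q Sep y∈C
        ... | no  y∉C = q⊆p∪q C Sep (select⁺ Sep? (y∈U , y∉C , x , x∈C , Adj-sym x~y))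
        x∉X : x ∉ X
        x∉X x∈X = proj₂ (R-far (C⊆R x∈C)) (X⊆N[v] x∈X (proj₁ (R-far (C⊆R x∈C))))

      result : ∃[ x ] (Simplicial U x × x ∉ X)
      result = lift (IH {U′} (p⊂q⇒∣p∣<∣q∣ U′⊂U) Sep-clique (q⊆p∪q C Sep) (p⊆p∪q Sep c₀∈C) c₀∉Sep)

    Universal : Set
    Universal = ∀ {y} → y ∈ U → y ≢ v → Adj K v y

    -- Either recurse on U - v, or every other vertex lies in X and v itself is simplicial.
    universal-result : Universal → ∀ {a} → a ∈ U → a ∉ X → ∃[ x ] (Simplicial U x × x ∉ X)
    universal-result universal a∈U a∉X with any? (λ b → b ∈? U - v ×-dec ¬? (b ∈? X))
    ... | yes (b , b∈U-v , b∉X) with IH (x∈p⇒∣p-x∣<∣p∣ v∈U) (λ a∈ b∈ → clique (x∈p-y⇒x∈p a∈) (x∈p-y⇒x∈p b∈))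
                                      (λ x∈ → x∈p∧x≢y⇒x∈p-y (X⊆U (x∈p-y⇒x∈p x∈)) (x∈p-y⇒x≢y x∈))
                                      b∈U-v (b∉X ∘ x∈p-y⇒x∈p)
    ...   | x , simp , x∉X-v =
      x , Simplicial-insert-universal universal simp , x∉X-v ∘ λ x∈X → x∈p∧x≢y⇒x∈p-y x∈X (x∈p-y⇒x≢y (proj₁ simp))
    universal-result universal a∈U a∉X | no ∄ =
      v , (v∈U , λ a∈U b∈U v~a v~b → clique (in-X a∈U v~a) (in-X b∈U v~b)) , λ v∈X → a∉X (in-X′ a∈U λ { refl → a∉X v∈X })
      where
      in-X′ : ∀ {y} → y ∈ U → y ≢ v → y ∈ X
      in-X′ {y} y∈U y≢v = decidable-stable (y ∈? X) λ y∉X → ∄ (y , x∈p∧x≢y⇒x∈p-y y∈U y≢v , y∉X)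
      in-X : ∀ {y} → y ∈ U → Adj K v y → y ∈ X
      in-X y∈U v~y = in-X′ y∈U (Adj⇒≢ v~y ∘ sym)

    result : ∀ {a} → a ∈ U → a ∉ X → ∃[ x ] (Simplicial U x × x ∉ X)
    result a∈U a∉X with any? (_∈? R)
    ... | yes (c₀ , c₀∈R) = Component.result c₀∈R
    ... | no  ∄           = universal-result universal a∈U a∉X
      where
      universal : Universal
      universal {y} y∈U y≢v = decidable-stable (Adj? v y) λ ¬v~y → ∄ (y , select⁺ R? (y∈U , y≢v , ¬v~y))

  simplicial-outside-clique : Chordal K → ∀ U → SimplicialOutside U
  simplicial-outside-clique chordal U = go U (ℕ.<-wellFounded ∣ U ∣)
    where
    go : ∀ U → Acc _<_ ∣ U ∣ → SimplicialOutside U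
    go U (acc rec) {X} clique X⊆U a∈U a∉X with any? (_∈? X)
    ... | yes (v , v∈X) = SimplicialStep.result chordal (λ lt → go _ (rec lt)) clique X⊆U (X⊆U v∈X)
                            (λ x∈X x≢v → clique v∈X x∈X (x≢v ∘ sym)) a∈U a∉X
    ... | no  ∄         = SimplicialStep.result chordal (λ lt → go _ (rec lt)) clique X⊆U a∈U
                            (λ x∈X → contradiction (_ , x∈X) ∄) a∈U a∉X

  simplicial-vertex : Chordal K → ∀ U → Nonempty U → ∃[ x ] Simplicial U x
  simplicial-vertex chordal U (a , a∈U) with simplicial-outside-clique chordal U (λ a∈⊥ → contradiction a∈⊥ ∉⊥) ⊥⊆ a∈U ∉⊥
  ... | x , simp , _ = x , simp

infix 4 _≅_
_≅_ : Complex n → Complex n → Set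
Δ ≅ Δ′ = ∀ F → Δ F ⇔ Δ′ F

≅-sym : ∀ {Δ Δ′ : Complex n} → Δ ≅ Δ′ → Δ′ ≅ Δ
≅-sym Δ≅Δ′ F = ⇔.sym (Δ≅Δ′ F)

IsFacet-resp : ∀ {Δ Δ′ : Complex n} → Δ ≅ Δ′ → ∀ {F} → IsFacet Δ F → IsFacet Δ′ F
IsFacet-resp Δ≅Δ′ (F∈Δ , maximal) =
  Equivalence.to (Δ≅Δ′ _) F∈Δ , λ H H∈Δ′ F⊆H → maximal H (Equivalence.from (Δ≅Δ′ H) H∈Δ′) F⊆H

VertexDecomposable-resp : ∀ {Δ Δ′ : Complex n} → Δ ≅ Δ′ → VertexDecomposable Δ → VertexDecomposable Δ′
VertexDecomposable-resp Δ≅Δ′ (simplex σ Δ⇔⊆σ) = simplex σ λ F → ⇔.trans (⇔.sym (Δ≅Δ′ F)) (Δ⇔⊆σ F)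
VertexDecomposable-resp Δ≅Δ′ (emptyCx Δ⇔≡⊥)   = emptyCx λ F → ⇔.trans (⇔.sym (Δ≅Δ′ F)) (Δ⇔≡⊥ F)
VertexDecomposable-resp Δ≅Δ′ (void ∄)         = void λ F → ∄ F ∘ Equivalence.from (Δ≅Δ′ F)
VertexDecomposable-resp {Δ = Δ} {Δ′} Δ≅Δ′ (shedding x x∈Δ lk del facets) =
  shedding x (Equivalence.to (Δ≅Δ′ _) x∈Δ)
    (VertexDecomposable-resp (λ F → ⇔.refl ×-⇔ Δ≅Δ′ _) lk)
    (VertexDecomposable-resp del≅ del)
    (λ F → IsFacet-resp Δ≅Δ′ ∘ facets F ∘ IsFacet-resp (≅-sym del≅))
  where
  del≅ : deletion Δ x ≅ deletion Δ′ x
  del≅ F = ⇔.refl ×-⇔ Δ≅Δ′ F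

-- The complexes Σ[ S , T ]

module _ (G : Graph n) (r : ℕ) where
  open Graphs G
  open Graphs (complement G) using () renaming (Simplicial to Simplicialᶜ; simplicial-vertex to simplicial-vertexᶜ)

  record Admissible (S T W : Subset n) : Set where
    constructor admissible
    field
      size      : ∣ W ∣ ≡ r
      connected : InducedConnected G W
      S⊆W       : S ⊆ W
      W⊆∁T      : W ⊆ ∁ T

  admissible? : ∀ S T W → Dec (Admissible S T W)
  admissible? S T W = map′ from to (∣ W ∣ ℕ.≟ r ×-dec connected? W ×-dec S ⊆? W ×-dec W ⊆? ∁ T)
    where
    from : ∣ W ∣ ≡ r × InducedConnected G W × S ⊆ W × W ⊆ ∁ T → Admissible S T W
    from (size , conn , S⊆W , W⊆∁T) = admissible size conn S⊆W W⊆∁T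
    to : Admissible S T W → ∣ W ∣ ≡ r × InducedConnected G W × S ⊆ W × W ⊆ ∁ T
    to (admissible size conn S⊆W W⊆∁T) = size , conn , S⊆W , W⊆∁T

  Admissible-mono : ∀ {S′ S T W} → S′ ⊆ S → Admissible S T W → Admissible S′ T W
  Admissible-mono S′⊆S (admissible size conn S⊆W W⊆∁T) = admissible size conn (S⊆W ∘ S′⊆S) W⊆∁T

  Σ[_,_] : Subset n → Subset n → Complex n
  Σ[ S , T ] F = ∃[ W ] (Admissible S T W × F ⊆ ∁ W × F ⊆ ∁ T)

  Σ[⊥,⊥]≅Sigma : Σ[ ⊥ , ⊥ ] ≅ Sigma G r
  Σ[⊥,⊥]≅Sigma F = mk⇔ (λ (W , A , F⊆∁W , _) → W , Admissible.size A , Admissible.connected A , F⊆∁W)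
                       (λ (W , size , conn , F⊆∁W) →
                          W , admissible size conn ⊥⊆ (λ _ → x∉p⇒x∈∁p ∉⊥) , F⊆∁W , λ _ → x∉p⇒x∈∁p ∉⊥)

  Σ-face? : ∀ S T y → Dec (Σ[ S , T ] ⁅ y ⁆)
  Σ-face? S T y = anySubset? λ W → admissible? S T W ×-dec ⁅ y ⁆ ⊆? ∁ W ×-dec ⁅ y ⁆ ⊆? ∁ T

  Σ-weaken : ∀ {S T y F} → Σ[ S ∪ ⁅ y ⁆ , T ] F → Σ[ S , T ] F
  Σ-weaken (W , A , F⊆∁W , F⊆∁T) = W , Admissible-mono x∈p⇒x∈p∪⁅y⁆ A , F⊆∁W , F⊆∁T

  Σ-link : ∀ {S T y} → y ∉ T → Σ[ S , T ∪ ⁅ y ⁆ ] ≅ link Σ[ S , T ] y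
  Σ-link {S} {T} {y} y∉T F = mk⇔ to from
    where
    to : Σ[ S , T ∪ ⁅ y ⁆ ] F → link Σ[ S , T ] y F
    to (W , admissible size conn S⊆W W⊆∁T∪y , F⊆∁W , F⊆∁T∪y) =
        (λ y∈F → proj₂ (x∈∁[p∪⁅y⁆]⁻ (F⊆∁T∪y y∈F)) refl)
      , W , admissible size conn S⊆W (x∉p⇒x∈∁p ∘ proj₁ ∘ x∈∁[p∪⁅y⁆]⁻ ∘ W⊆∁T∪y)
      , p∪⁅y⁆⊆q F⊆∁W (x∉p⇒x∈∁p λ y∈W → proj₂ (x∈∁[p∪⁅y⁆]⁻ (W⊆∁T∪y y∈W)) refl)
      , p∪⁅y⁆⊆q (x∉p⇒x∈∁p ∘ proj₁ ∘ x∈∁[p∪⁅y⁆]⁻ ∘ F⊆∁T∪y) (x∉p⇒x∈∁p y∉T)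
    from : link Σ[ S , T ] y F → Σ[ S , T ∪ ⁅ y ⁆ ] F
    from (y∉F , W , admissible size conn S⊆W W⊆∁T , F∪y⊆∁W , F∪y⊆∁T) =
        W , admissible size conn S⊆W (λ w∈W → x∈∁[p∪⁅y⁆]⁺ (x∈∁p⇒x∉p (W⊆∁T w∈W)) λ { refl → y∉W w∈W })
      , F∪y⊆∁W ∘ x∈p⇒x∈p∪⁅y⁆
      , λ x∈F → x∈∁[p∪⁅y⁆]⁺ (x∈∁p⇒x∉p (F∪y⊆∁T (x∈p⇒x∈p∪⁅y⁆ x∈F))) λ { refl → y∉F x∈F }
      where
      y∉W : y ∉ W
      y∉W = x∈∁p⇒x∉p (F∪y⊆∁W y∈p∪⁅y⁆)

  Admissible-insert : ∀ {S T W y} → Admissible S T W → y ∈ W → Admissible (S ∪ ⁅ y ⁆) T W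
  Admissible-insert (admissible size conn S⊆W W⊆∁T) y∈W = admissible size conn (p∪⁅y⁆⊆q S⊆W y∈W) W⊆∁T

  Admissible-exchange : ∀ {S T W y z} → Admissible S T W → y ∉ W → y ∉ T → z ∈ W → z ∉ S
                      → InducedConnected G ((W - z) ∪ ⁅ y ⁆) → Admissible (S ∪ ⁅ y ⁆) T ((W - z) ∪ ⁅ y ⁆)
  Admissible-exchange {W = W} (admissible size conn S⊆W W⊆∁T) y∉W y∉T z∈W z∉S conn′ = admissible
    (trans (∣p-x∪⁅y⁆∣≡∣p∣ W z∈W y∉W) size)
    conn′
    (p∪⁅y⁆⊆q (λ s∈S → x∈p⇒x∈p∪⁅y⁆ (x∈p∧x≢y⇒x∈p-y (S⊆W s∈S) λ { refl → z∉S s∈S })) y∈p∪⁅y⁆)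
    (p∪⁅y⁆⊆q (W⊆∁T ∘ x∈p-y⇒x∈p) (x∉p⇒x∈∁p y∉T))

  Shedding : Subset n → Subset n → Fin n → Set
  Shedding S T y = ∀ {W} → Admissible S T W → y ∉ W → ∃[ z ] (z ∈ W × z ∉ S × InducedConnected G ((W - z) ∪ ⁅ y ⁆))

  Σ-deletion : ∀ {S T y} → y ∉ T → Shedding S T y → Σ[ S ∪ ⁅ y ⁆ , T ] ≅ deletion Σ[ S , T ] y
  Σ-deletion {S} {T} {y} y∉T shed F = mk⇔ to from
    where
    to : Σ[ S ∪ ⁅ y ⁆ , T ] F → deletion Σ[ S , T ] y F
    to F∈Σ@(W , A , F⊆∁W , _) = (λ y∈F → x∈∁p⇒x∉p (F⊆∁W y∈F) (Admissible.S⊆W A y∈p∪⁅y⁆)) , Σ-weaken F∈Σ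
    from : deletion Σ[ S , T ] y F → Σ[ S ∪ ⁅ y ⁆ , T ] F
    from (y∉F , W , A , F⊆∁W , F⊆∁T) with y ∈? W
    ... | yes y∈W = W , Admissible-insert A y∈W , F⊆∁W , F⊆∁T
    ... | no  y∉W with shed A y∉W
    ...   | z , z∈W , z∉S , conn′ = _ , Admissible-exchange A y∉W y∉T z∈W z∉S conn′ , F⊆∁W′ , F⊆∁T
      where
      F⊆∁W′ : F ⊆ ∁ ((W - z) ∪ ⁅ y ⁆)
      F⊆∁W′ x∈F = x∈∁[p∪⁅y⁆]⁺ (x∈∁p⇒x∉p (F⊆∁W x∈F) ∘ x∈p-y⇒x∈p) λ { refl → y∉F x∈F }

  -- A face H ∋ y above a facet F of the deletion could be traded for (H - y) ∪ ⁅ z ⁆, a face of the deletion above F.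
  Σ-facets : ∀ {S T y} → Shedding S T y → ∀ F → IsFacet (deletion Σ[ S , T ] y) F → IsFacet Σ[ S , T ] F
  Σ-facets {S} {T} {y} shed F ((y∉F , F∈Σ) , maximal) = F∈Σ , above
    where
    above : ∀ H → Σ[ S , T ] H → F ⊆ H → H ≡ F
    above H H∈Σ F⊆H with y ∈? H
    ... | no  y∉H = maximal H (y∉H , H∈Σ) F⊆H
    ... | yes y∈H with H∈Σ
    ...   | W , A , H⊆∁W , H⊆∁T with shed A (x∈∁p⇒x∉p (H⊆∁W y∈H))
    ...     | z , z∈W , z∉S , conn′ = contradiction z∈W (x∈∁p⇒x∉p (H⊆∁W (F⊆H z∈F)))
      where
      y∉W : y ∉ W
      y∉W = x∈∁p⇒x∉p (H⊆∁W y∈H)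
      z≢y : z ≢ y
      z≢y refl = y∉W z∈W
      H′ : Subset n
      H′ = (H - y) ∪ ⁅ z ⁆
      H′⊆∁W′ : H′ ⊆ ∁ ((W - z) ∪ ⁅ y ⁆)
      H′⊆∁W′ = p∪⁅y⁆⊆q
        (λ x∈H-y → x∈∁[p∪⁅y⁆]⁺ (x∈∁p⇒x∉p (H⊆∁W (x∈p-y⇒x∈p x∈H-y)) ∘ x∈p-y⇒x∈p) (x∈p-y⇒x≢y x∈H-y))
        (x∈∁[p∪⁅y⁆]⁺ (λ z∈W-z → x∈p-y⇒x≢y z∈W-z refl) z≢y)
      H′∈deletion : deletion Σ[ S , T ] y H′
      H′∈deletion =
          [ (λ y∈H-y → x∈p-y⇒x≢y y∈H-y refl) , z≢y ∘ sym ]′ ∘ x∈p∪⁅y⁆⁻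
        , _ , Admissible-mono x∈p⇒x∈p∪⁅y⁆ (Admissible-exchange A y∉W (x∈∁p⇒x∉p (H⊆∁T y∈H)) z∈W z∉S conn′)
        , H′⊆∁W′
        , p∪⁅y⁆⊆q (H⊆∁T ∘ x∈p-y⇒x∈p) (Admissible.W⊆∁T A z∈W)
      F⊆H′ : F ⊆ H′
      F⊆H′ x∈F = x∈p⇒x∈p∪⁅y⁆ (x∈p∧x≢y⇒x∈p-y (F⊆H x∈F) λ { refl → y∉F x∈F })
      z∈F : z ∈ F
      z∈F = subst (z ∈_) (maximal H′ H′∈deletion F⊆H′) y∈p∪⁅y⁆

  Σ-without : ∀ {S T y} → y ∉ T → ¬ Σ[ S , T ] ⁅ y ⁆ → Σ[ S ∪ ⁅ y ⁆ , T ] ≅ Σ[ S , T ]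
  Σ-without {S} {T} {y} y∉T y∉Σ F = mk⇔ Σ-weaken from
    where
    from : Σ[ S , T ] F → Σ[ S ∪ ⁅ y ⁆ , T ] F
    from (W , A , F⊆∁W , F⊆∁T) with y ∈? W
    ... | yes y∈W = W , Admissible-insert A y∈W , F⊆∁W , F⊆∁T
    ... | no  y∉W = contradiction (W , A , (λ {_} → ⁅x⁆⊆∁p y∉W) , λ {_} → ⁅x⁆⊆∁p y∉T) y∉Σ

  Σ-simplex : ∀ {S T} → ∣ S ∣ ≡ r → InducedConnected G S → S ⊆ ∁ T → ∀ F → Σ[ S , T ] F ⇔ F ⊆ ∁ (S ∪ T)
  Σ-simplex {S} {T} ∣S∣≡r S-conn S⊆∁T F = mk⇔ to from
    where
    to : Σ[ S , T ] F → F ⊆ ∁ (S ∪ T)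
    to (W , A , F⊆∁W , F⊆∁T) x∈F =
      x∉p⇒x∈∁p ([ x∈∁p⇒x∉p (F⊆∁W x∈F) ∘ Admissible.S⊆W A , x∈∁p⇒x∉p (F⊆∁T x∈F) ]′ ∘ x∈p∪q⁻ S T)
    from : F ⊆ ∁ (S ∪ T) → Σ[ S , T ] F
    from F⊆∁S∪T = S , admissible ∣S∣≡r S-conn id S⊆∁T
                 , (λ x∈F → x∉p⇒x∈∁p (x∈∁p⇒x∉p (F⊆∁S∪T x∈F) ∘ p⊆p∪q T))
                 , (λ x∈F → x∉p⇒x∈∁p (x∈∁p⇒x∉p (F⊆∁S∪T x∈F) ∘ q⊆p∪q S T))

  Σ-stuck : ∀ {S T s} → s ∈ S → ∣ S ∣ ≢ r → (∀ {u y} → u ∈ S → y ∉ S → y ∉ T → ¬ Adj G u y) → ∀ F → ¬ Σ[ S , T ] F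
  Σ-stuck s∈S ∣S∣≢r isolated _ (W , admissible size conn S⊆W W⊆∁T , _)
    with ∃-missing S⊆W (λ ∣S∣≡∣W∣ → ∣S∣≢r (trans ∣S∣≡∣W∣ size))
  ... | w , w∈W , w∉S with leaving-edge (conn _ _ (S⊆W s∈S) w∈W) s∈S w∉S
  ...   | u , v , u∈S , v∈W , v∉S , u~v = isolated u∈S v∉S (x∈∁p⇒x∉p (W⊆∁T v∈W)) u~v

  Σ-no-room : ∀ {S T} → 2 ≤ r → Empty (∁ T) → ∀ F → ¬ Σ[ S , T ] F
  Σ-no-room 2≤r ∄ _ (W , admissible size conn _ W⊆∁T , _) with connected-edge conn (subst (2 ≤_) (sym size) 2≤r)
  ... | a , _ , a∈W , _ = ∄ (a , W⊆∁T a∈W)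

  shedding-adjacent : ∀ {S T s y} → InducedConnected G S → s ∈ S → Adj G s y → ∣ S ∣ ≢ r → Shedding S T y
  shedding-adjacent S-conn s∈S s~y ∣S∣≢r (admissible size conn S⊆W _) _
    with ∃-missing S⊆W (λ ∣S∣≡∣W∣ → ∣S∣≢r (trans ∣S∣≡∣W∣ size))
  ... | w , w∈W , w∉S = exchange S-conn S⊆W conn s∈S s~y w∈W w∉S

  -- a ~ c in G, so a and c are not adjacent in the complement, where x is simplicial.
  adjacent-to-edge : ∀ {U x a c} → Simplicialᶜ U x → a ∈ U → c ∈ U → x ≢ a → x ≢ c → Adj G a c
                   → Adj G x a ⊎ Adj G x c
  adjacent-to-edge {x = x} {a} {c} (_ , simp) a∈U c∈U x≢a x≢c a~c with Adj? x a | Adj? x c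
  ... | yes x~a | _       = inj₁ x~a
  ... | no  _   | yes x~c = inj₂ x~c
  ... | no ¬x~a | no ¬x~c = contradiction a~c
    (Adj-complement⁻ {G = G} (simp a∈U c∈U (Adj-complement⁺ {G = G} x≢a ¬x~a) (Adj-complement⁺ {G = G} x≢c ¬x~c) (Adj⇒≢ a~c)))

  shedding-simplicial : 2 ≤ r → ∀ {S T x} → Empty S → Simplicialᶜ (∁ T) x → Shedding S T x
  shedding-simplicial 2≤r {S} {T} {x} ∅ simp {W} (admissible size conn _ W⊆∁T) x∉W
    with connected-edge conn (subst (2 ≤_) (sym size) 2≤r)
  ... | a , c , a∈W , c∈W , a~c =
    [ (λ x~a → avoiding-S (exchange-⁅⁆ conn a∈W c∈W (Adj⇒≢ a~c ∘ sym) (Adj-sym x~a)))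
    , (λ x~c → avoiding-S (exchange-⁅⁆ conn c∈W a∈W (Adj⇒≢ a~c) (Adj-sym x~c)))
    ]′ (adjacent-to-edge simp (W⊆∁T a∈W) (W⊆∁T c∈W) (λ { refl → x∉W a∈W }) (λ { refl → x∉W c∈W }) a~c)
    where
    avoiding-S : ∃[ z ] (z ∈ W × InducedConnected G ((W - z) ∪ ⁅ x ⁆))
               → ∃[ z ] (z ∈ W × z ∉ S × InducedConnected G ((W - z) ∪ ⁅ x ⁆))
    avoiding-S (z , z∈W , conn′) = z , z∈W , (λ z∈S → ∅ (z , z∈S)) , conn′

  data Shape (S T : Subset n) : Set where
    full    : (∀ F → Σ[ S , T ] F ⇔ F ⊆ ∁ (S ∪ T)) → Shape S T
    stuck   : (∀ F → ¬ Σ[ S , T ] F) → Shape S T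
    growing : ∀ {y} → y ∉ S → y ∉ T → InducedConnected G (S ∪ ⁅ y ⁆) → Shedding S T y → Shape S T

  shape : 2 ≤ r → Chordal (complement G) → ∀ {S T} → InducedConnected G S → S ⊆ ∁ T → Shape S T
  shape 2≤r chordal {S} {T} S-conn S⊆∁T with ∣ S ∣ ℕ.≟ r | nonempty? S
  ... | yes ∣S∣≡r | _             = full (Σ-simplex ∣S∣≡r S-conn S⊆∁T)
  ... | no  ∣S∣≢r | yes (s , s∈S) with any? (λ y → ¬? (y ∈? S) ×-dec ¬? (y ∈? T) ×-dec any? (λ u → u ∈? S ×-dec Adj? u y))
  ...   | yes (y , y∉S , y∉T , u , u∈S , u~y) =
    growing y∉S y∉T (connected-∪⁅⁆ S-conn u∈S u~y) (shedding-adjacent S-conn u∈S u~y ∣S∣≢r)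
  ...   | no ∄ = stuck (Σ-stuck s∈S ∣S∣≢r λ u∈S y∉S y∉T u~y → ∄ (_ , y∉S , y∉T , _ , u∈S , u~y))
  shape 2≤r chordal {S} {T} S-conn S⊆∁T | no _ | no ∅ with any? (_∈? ∁ T)
  ... | no ∄ = stuck (Σ-no-room 2≤r ∄)
  ... | yes nonempty-∁T with simplicial-vertexᶜ chordal (∁ T) nonempty-∁T
  ...   | x , simp = growing (λ x∈S → ∅ (x , x∈S)) (x∈∁p⇒x∉p (proj₁ simp)) S∪x-conn (shedding-simplicial 2≤r ∅ simp)
    where
    S∪x-conn : InducedConnected G (S ∪ ⁅ x ⁆)
    S∪x-conn = connected-subsingleton λ u∈ v∈ → trans (only-x u∈) (sym (only-x v∈))
      where
      only-x : ∀ {u} → u ∈ S ∪ ⁅ x ⁆ → u ≡ x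
      only-x u∈ = [ (λ u∈S → contradiction (_ , u∈S) ∅) , id ]′ (x∈p∪⁅y⁆⁻ u∈)

  decompose-at : ∀ {S T y} → y ∉ T → Shedding S T y
               → VertexDecomposable Σ[ S ∪ ⁅ y ⁆ , T ] → VertexDecomposable Σ[ S , T ∪ ⁅ y ⁆ ] → VertexDecomposable Σ[ S , T ]
  decompose-at {S} {T} {y} y∉T shed del-vd link-vd with Σ-face? S T y
  ... | yes y∈Σ = shedding y y∈Σ (VertexDecomposable-resp (Σ-link y∉T) link-vd)
                                 (VertexDecomposable-resp (Σ-deletion y∉T shed) del-vd) (Σ-facets shed)
  ... | no  y∉Σ = VertexDecomposable-resp (Σ-without y∉T y∉Σ) del-vd

  Σ-vertex-decomposable : 2 ≤ r → Chordal (complement G) → ∀ S T → InducedConnected G S → S ⊆ ∁ T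
                        → VertexDecomposable Σ[ S , T ]
  Σ-vertex-decomposable 2≤r chordal S T = go S T (ℕ.<-wellFounded _)
    where
    go : ∀ S T → Acc _<_ (∣ ∁ S ∣ + ∣ ∁ T ∣) → InducedConnected G S → S ⊆ ∁ T → VertexDecomposable Σ[ S , T ]
    go S T (acc rec) S-conn S⊆∁T with shape 2≤r chordal S-conn S⊆∁T
    ... | full Σ⇔⊆ = simplex _ Σ⇔⊆
    ... | stuck ∄  = void ∄
    ... | growing y∉S y∉T S∪y-conn shed = decompose-at y∉T shed
      (go _ T (rec (ℕ.+-monoˡ-< _ (∣∁[p∪⁅x⁆]∣<∣∁p∣ y∉S))) S∪y-conn (p∪⁅y⁆⊆q S⊆∁T (x∉p⇒x∈∁p y∉T)))
      (go S _ (rec (ℕ.+-monoʳ-< _ (∣∁[p∪⁅x⁆]∣<∣∁p∣ y∉T))) S-conn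
        λ s∈S → x∈∁[p∪⁅y⁆]⁺ (x∈∁p⇒x∉p (S⊆∁T s∈S)) λ { refl → y∉S s∈S })

theorem4p3 : (n : ℕ) (G : Graph n) (r : ℕ) → 2 ≤ r → Chordal (complement G) → VertexDecomposable (Sigma G r)
theorem4p3 n G r 2≤r chordal = VertexDecomposable-resp (Σ[⊥,⊥]≅Sigma G r)
  (Σ-vertex-decomposable G r 2≤r chordal ⊥ ⊥ (λ _ _ u∈⊥ → contradiction u∈⊥ ∉⊥) (λ x∈⊥ → contradiction x∈⊥ ∉⊥))
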